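{- Let $G=(B\cup W,E)$ be a bipartite graph (an instance of Bipartite Influence), and let $B_0\subseteq B$ and $W_0\subseteq W$. Then $Ls(G)\leq Ls(G\setminus W_0)+|W_0|$, $Rs(G)\geq Rs(G\setminus B_0)-|B_0|$, $Ls(G)\geq Ls(G\setminus B_0)-|B_0|$, and $Rs(G)\leq Rs(G\setminus W_0)+|W_0|$, where $G\setminus X$ denotes the subgraph induced by the vertices not in $X$.
   Context: Bipartite Influence: an instance is a finite bipartite graph $G=(B\cup W,E)$ whose vertices in $B$ are black (owned by Left) and in $W$ white (owned by Right), every edge joining $B$ and $W$. Players alternate; Left chooses a black vertex, Right a white vertex. Playing vertex $v$ removes the set $Rmv(G,v)$ consisting of $v$, all neighbours of $v$, and all vertices that become isolated once $v$ and its neighbours are removed; the mover is credited with these $|Rmv(G,v)|$ vertices. The score is the number of vertices credited to Left minus the number credited to Right. Formally, if $G$ has no edges then $Ls(G)=Rs(G)=|B|-|W|$ (isolated vertices are credited to their owner); otherwise $Ls(G)=\max_{x\in B}\{|Rmv(G,x)|+Rs(G\setminus Rmv(G,x))\}$ and $Rs(G)=\min_{y\in W}\{ -|Rmv(G,y)|+Ls(G\setminus Rmv(G,y))\}$. $Ls(G)$ (resp. $Rs(G)$) is the optimal score when Left (resp. Right) moves first. -}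

module Defs where

open import Data.Nat using (ℕ; zero; suc)
import Data.Bool
open import Data.Bool using (Bool; true; false; _∧_; _∨_; not; if_then_else_)
open import Data.Fin using (Fin; _≟_)
open import Data.Fin.Subset using (Subset; _∪_; _∩_; _─_; ∣_∣)
open import Data.Vec using (lookup; tabulate)
open import Data.List using (List; []; _∷_; map; foldr; filterᵇ; allFin)
open import Data.Integer using (ℤ; +_; _+_; _-_; -_; _⊔_; _⊓_)
open import Relation.Nullary.Decidable using (⌊_⌋)
open import Relation.Binary.PropositionalEquality using (_≡_)

-- A finite bipartite graph on vertex set Fin n.
-- colour v = true  : v is black (owned by Left)
-- colour v = false : v is white (owned by Right)
-- adj u v = true   : u and v are joined by an edge
record BipGraph (n : ℕ) : Set where
  field
    colour  : Fin n → Bool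
    adj     : Fin n → Fin n → Bool
    adj-sym : ∀ u v → adj u v ≡ adj v u
    adj-bip : ∀ u v → adj u v ≡ true → colour u ≡ not (colour v)
open BipGraph public

module _ {n : ℕ} (G : BipGraph n) where

  mem : Subset n → Fin n → Bool
  mem S v = lookup S v

  anyFin : ∀ {m} → (Fin m → Bool) → Bool
  anyFin p = foldr _∨_ false (map p (allFin _))

  hasNbr : Subset n → Fin n → Bool
  hasNbr S u = anyFin (λ w → mem S w ∧ adj G u w)

  hasEdge : Subset n → Bool
  hasEdge S = anyFin (λ u → mem S u ∧ hasNbr S u)

  closedNbh : Subset n → Fin n → Subset n
  closedNbh S v = tabulate (λ u → mem S u ∧ (⌊ u ≟ v ⌋ ∨ adj G v u))

  -- Rmv(G[S], v): v, its neighbours, and the vertices that become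
  -- isolated once v and its neighbours are removed (i.e. non-isolated in
  -- G[S] but isolated in G[S ─ N[v]]).
  Rmv : Subset n → Fin n → Subset n
  Rmv S v = closedNbh S v ∪
            tabulate (λ u → mem R u ∧ hasNbr S u ∧ not (hasNbr R u))
    where R = S ─ closedNbh S v

  blacks whites : Subset n
  blacks = tabulate (colour G)
  whites = tabulate (λ v → not (colour G v))

  base : Subset n → ℤ
  base S = + ∣ S ∩ blacks ∣ - + ∣ S ∩ whites ∣

  maxList minList : List ℤ → ℤ
  maxList []       = + 0
  maxList (x ∷ xs) = foldr _⊔_ x xs
  minList []       = + 0
  minList (x ∷ xs) = foldr _⊓_ x xs

  moves : Bool → Subset n → List (Fin n)
  moves c S = filterᵇ (λ v → mem S v ∧ ⌊ Data.Bool._≟_ (colour G v) c ⌋) (allFin n)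

  -- Scores with a fuel parameter; fuel ≥ |S| suffices since each move
  -- removes at least the played vertex.
  Ls′ Rs′ : ℕ → Subset n → ℤ
  Ls′ zero    S = base S
  Ls′ (suc k) S =
    if hasEdge S
    then maxList (map (λ x → + ∣ Rmv S x ∣ + Rs′ k (S ─ Rmv S x)) (moves true S))
    else base S
  Rs′ zero    S = base S
  Rs′ (suc k) S =
    if hasEdge S
    then minList (map (λ y → - (+ ∣ Rmv S y ∣) + Ls′ k (S ─ Rmv S y)) (moves false S))
    else base S

  Ls Rs : Subset n → ℤ
  Ls S = Ls′ n S
  Rs S = Rs′ n S

module Submission where

-- Delete a set W of white vertices and play a position P of G against a position K of
-- G ∖ W side by side.  A Left move in P is answered in K by the same vertex if it is still
-- there and by an arbitrary black vertex otherwise; a Right move in K is copied in P.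
-- The invariant "every vertex of P ∖ K adjacent to K is white, and every vertex of K ∖ P is
-- black and isolated in K" survives these paired moves, and a copied Right move removes
-- at least as many vertices from P as from K.  Induction on |P| then bounds both
-- Ls P - Ls K and Rs P - Rs K by |P| - |K|, which is |W| at the start.  The bounds for
-- black vertices follow by swapping the colours, which exchanges Ls and Rs up to sign.

open import Defs
open import Data.Nat using (ℕ; zero; suc)
open import Data.Bool using (true; false)
open import Data.Product using (_×_)
open import Data.Fin.Subset using (Subset; _∈_; ⊤; ∁; ∣_∣)
open import Data.Integer using (_≤_; _+_; _-_; +_)
open import Relation.Binary.PropositionalEquality using (_≡_)

open import Data.Bool using (Bool; T; _∧_; not)
import Data.Bool as Bool
open import Data.Bool.Properties using (T-≡; T-∧; T-∨; T-not-≡; not-¬; ¬-not; not-involutive)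
open import Data.Empty using (⊥)
open import Data.Fin using (Fin)
open import Data.Fin.Subset using (_∉_; _⊆_; _∩_; _─_; inside; outside)
open import Data.Fin.Subset.Properties
  using ( _∈?_; ∈⊤; drop-there; ⊆-antisym; p∩q⊆q; x∈p∩q⁺; x∈p∩q⁻; x∈p∪q⁺; x∈p∪q⁻; ∩-identityˡ
        ; x∈p∧x∉q⇒x∈p─q; p─q⊆p; x∈∁p⇒x∉p; x∉p⇒x∈∁p; x∉∁p⇒x∈p
        ; ∣p∣≤n; p⊆q⇒∣p∣≤∣q∣; x∈p⇒∣p-x∣<∣p∣; p∩q≢∅⇒∣p─q∣<∣p∣ )
open import Data.Integer using (ℤ; -_; _⊔_; _⊓_; +≤+; nonNegative)
import Data.Integer.Properties as ℤ
open import Data.Integer.Tactic.RingSolver using (solve-∀)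
import Data.Nat as ℕ
import Data.Nat.Properties as ℕ
open import Data.List using ([]; _∷_; map; filterᵇ; allFin)
open import Data.List.Membership.Propositional using (lose) renaming (_∈_ to _∈ₗ_)
open import Data.List.Membership.Propositional.Properties using (∈-allFin; ∈-filter⁺; ∈-filter⁻; ∈-map⁺)
open import Data.List.Properties
  using (foldr-preservesᵇ; foldr-preservesᵒ; foldr-map; foldr-fusion; map-cong; map-cong-local; map-∘; filter-≐)
open import Data.List.Relation.Unary.All as All using (All; _∷_)
import Data.List.Relation.Unary.All.Properties as All
open import Data.List.Relation.Unary.Any as Any using (Any; satisfied)
open import Data.List.Relation.Unary.Any.Properties using (any⁺; any⁻)
open import Data.Product using (∃; _,_; proj₁; proj₂)
import Data.Product as Product
open import Data.Product.Function.NonDependent.Propositional using (_×-⇔_)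
open import Data.Sum using (_⊎_; inj₁; inj₂; [_,_])
open import Data.Sum.Function.Propositional using (_⊎-⇔_)
open import Data.Vec using (_∷_; []; here; there; lookup; tabulate)
open import Data.Vec.Properties using (lookup∘tabulate; []=⇒lookup; lookup⇒[]=; tabulate-∘; tabulate-cong)
open import Function using (_∘_; _⇔_; mk⇔; Equivalence)
import Function.Properties.Equivalence as ⇔
open import Function.Related.TypeIsomorphisms using (→-cong-⇔)
open import Relation.Nullary using (¬_; Dec; yes; no; contradiction)
open import Relation.Nullary.Decidable as Dec using (True; ⌊_⌋; toWitness; fromWitness; T?)
open import Relation.Binary.PropositionalEquality
  using (module ≡-Reasoning; _≢_; refl; sym; trans; cong; cong₂; subst; subst₂)

open Equivalence using (to; from)

∣_∣ℤ : ∀ {n} → Subset n → ℤ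
∣ p ∣ℤ = + ∣ p ∣

True⇔ : ∀ {A : Set} (a? : Dec A) → True a? ⇔ A
True⇔ a? = mk⇔ toWitness fromWitness

T-not⇔¬T : ∀ {b} → T (not b) ⇔ (¬ T b)
T-not⇔¬T {true}  = mk⇔ (λ ()) (λ ¬t → ¬t _)
T-not⇔¬T {false} = mk⇔ (λ _ ()) (λ _ → _)

¬-⇔ : ∀ {A B : Set} → A ⇔ B → (¬ A) ⇔ (¬ B)
¬-⇔ A⇔B = →-cong-⇔ A⇔B ⇔.refl

∃-⇔ : ∀ {A : Set} {P Q : A → Set} → (∀ {x} → P x ⇔ Q x) → ∃ P ⇔ ∃ Q
∃-⇔ P⇔Q = mk⇔ (Product.map₂ (to P⇔Q)) (Product.map₂ (from P⇔Q))

filterᵇ-cong : ∀ {A : Set} {p q : A → Bool} → (∀ x → p x ≡ q x) → ∀ xs → filterᵇ p xs ≡ filterᵇ q xs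
filterᵇ-cong {p = p} {q} p≗q =
  filter-≐ (T? ∘ p) (T? ∘ q) ((λ {x} → subst T (p≗q x)) , (λ {x} → subst T (sym (p≗q x))))

i-k≤j⇒i≤j+k : ∀ {i j k} → i - k ≤ j → i ≤ j + k
i-k≤j⇒i≤j+k {i} {j} {k} i-k≤j = ℤ.≤-trans (ℤ.≤-reflexive (split i k)) (ℤ.+-monoˡ-≤ k i-k≤j)
  where
  split : ∀ i k → i ≡ (i - k) + k
  split = solve-∀

-i≤-j+k⇒j-k≤i : ∀ {i} j {k} → - i ≤ - j + k → j - k ≤ i
-i≤-j+k⇒j-k≤i {i} j {k} h = subst₂ _≤_ (negate j k) (ℤ.neg-involutive i) (ℤ.neg-mono-≤ h)
  where
  negate : ∀ j k → - (- j + k) ≡ j - k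
  negate = solve-∀

∈⇔T-lookup : ∀ {n} {p : Subset n} {x} → x ∈ p ⇔ T (lookup p x)
∈⇔T-lookup {p = p} {x} = mk⇔ (from T-≡ ∘ []=⇒lookup) (lookup⇒[]= x p ∘ to T-≡)

∈-tabulate⇔ : ∀ {n} {f : Fin n → Bool} {x} → x ∈ tabulate f ⇔ T (f x)
∈-tabulate⇔ {f = f} {x} = mk⇔
  (λ x∈ → from T-≡ (trans (sym (lookup∘tabulate f x)) ([]=⇒lookup x∈)))
  (λ t → lookup⇒[]= x _ (trans (lookup∘tabulate f x) (to T-≡ t)))

x∈p─q⁻ : ∀ {n} {p q : Subset n} {x} → x ∈ p ─ q → x ∈ p × x ∉ q
x∈p─q⁻ {p = _ ∷ p} {outside ∷ q} here = here , λ ()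
x∈p─q⁻ {p = _ ∷ p} {inside ∷ q} {Fin.zero} ()
x∈p─q⁻ {p = _ ∷ p} {_ ∷ q} (there x∈p─q) =
  there (proj₁ (x∈p─q⁻ x∈p─q)) , proj₂ (x∈p─q⁻ x∈p─q) ∘ drop-there

x∈p∧x∉p─q⇒x∈q : ∀ {n} {p q : Subset n} {x} → x ∈ p → x ∉ p ─ q → x ∈ q
x∈p∧x∉p─q⇒x∈q {q = q} {x} x∈p x∉p─q with x ∈? q
... | yes x∈q = x∈q
... | no  x∉q = contradiction (x∈p∧x∉q⇒x∈p─q x∈p x∉q) x∉p─q

∣p∩q∣+∣p∩∁q∣≡∣p∣ : ∀ {n} (p q : Subset n) → ∣ p ∩ q ∣ ℕ.+ ∣ p ∩ ∁ q ∣ ≡ ∣ p ∣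
∣p∩q∣+∣p∩∁q∣≡∣p∣ []            []            = refl
∣p∩q∣+∣p∩∁q∣≡∣p∣ (inside  ∷ p) (inside  ∷ q) = cong suc (∣p∩q∣+∣p∩∁q∣≡∣p∣ p q)
∣p∩q∣+∣p∩∁q∣≡∣p∣ (inside  ∷ p) (outside ∷ q) =
  trans (ℕ.+-suc ∣ p ∩ q ∣ _) (cong suc (∣p∩q∣+∣p∩∁q∣≡∣p∣ p q))
∣p∩q∣+∣p∩∁q∣≡∣p∣ (outside ∷ p) (_       ∷ q) = ∣p∩q∣+∣p∩∁q∣≡∣p∣ p q

∣q∣+∣p─q∣≡∣p∣ : ∀ {n} {p q : Subset n} → q ⊆ p → ∣ q ∣ ℕ.+ ∣ p ─ q ∣ ≡ ∣ p ∣
∣q∣+∣p─q∣≡∣p∣ {p = p} {q} q⊆p =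
  subst₂ (λ a b → ∣ a ∣ ℕ.+ ∣ b ∣ ≡ ∣ p ∣) p∩q≡q p∩∁q≡p─q (∣p∩q∣+∣p∩∁q∣≡∣p∣ p q)
  where
  p∩q≡q : p ∩ q ≡ q
  p∩q≡q = ⊆-antisym (p∩q⊆q p q) (λ x∈q → x∈p∩q⁺ (q⊆p x∈q , x∈q))
  p∩∁q≡p─q : p ∩ ∁ q ≡ p ─ q
  p∩∁q≡p─q = ⊆-antisym
    (λ x∈ → let x∈p , x∈∁q = x∈p∩q⁻ p (∁ q) x∈ in x∈p∧x∉q⇒x∈p─q x∈p (x∈∁p⇒x∉p x∈∁q))
    (λ x∈ → let x∈p , x∉q = x∈p─q⁻ x∈ in x∈p∩q⁺ (x∈p , x∉p⇒x∈∁p x∉q))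

∣⊤∣-∣∁p∣≡∣p∣ : ∀ {n} (p : Subset n) → ∣ ⊤ {n} ∣ℤ - ∣ ∁ p ∣ℤ ≡ ∣ p ∣ℤ
∣⊤∣-∣∁p∣≡∣p∣ {n} p = begin
  ∣ ⊤ {n} ∣ℤ - ∣ ∁ p ∣ℤ            ≡⟨ cong (_- ∣ ∁ p ∣ℤ) ∣⊤∣≡∣p∣+∣∁p∣ ⟩
  (∣ p ∣ℤ + ∣ ∁ p ∣ℤ) - ∣ ∁ p ∣ℤ   ≡⟨ cancel ∣ p ∣ℤ ∣ ∁ p ∣ℤ ⟩
  ∣ p ∣ℤ                          ∎
  where
  open ≡-Reasoning
  ∣⊤∣≡∣p∣+∣∁p∣ : ∣ ⊤ {n} ∣ℤ ≡ ∣ p ∣ℤ + ∣ ∁ p ∣ℤ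
  ∣⊤∣≡∣p∣+∣∁p∣ = trans (cong +_ (sym (subst₂ (λ a b → ∣ a ∣ ℕ.+ ∣ b ∣ ≡ ∣ ⊤ {n} ∣)
                                            (∩-identityˡ p) (∩-identityˡ (∁ p)) (∣p∩q∣+∣p∩∁q∣≡∣p∣ ⊤ p))))
                       (ℤ.pos-+ ∣ p ∣ ∣ ∁ p ∣)
  cancel : ∀ a b → (a + b) - b ≡ a
  cancel = solve-∀

-- The graph argument of maxList and minList is unused.
module _ {n : ℕ} (G : BipGraph n) where

  ≤-maxList : ∀ {x xs} → x ∈ₗ xs → x ≤ maxList G xs
  ≤-maxList {x} {y ∷ ys} x∈ = foldr-preservesᵒ pres y ys (start x∈)
    where
    pres : ∀ a b → x ≤ a ⊎ x ≤ b → x ≤ a ⊔ b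
    pres a b = [ ℤ.i≤j⇒i≤j⊔k b , ℤ.i≤j⇒i≤k⊔j a ]
    start : x ∈ₗ y ∷ ys → x ≤ y ⊎ Any (x ≤_) ys
    start (Any.here refl)  = inj₁ ℤ.≤-refl
    start (Any.there x∈ys) = inj₂ (lose x∈ys ℤ.≤-refl)

  maxList-≤ : ∀ {x xs b} → x ∈ₗ xs → All (_≤ b) xs → maxList G xs ≤ b
  maxList-≤ {xs = y ∷ ys} _ (y≤b ∷ ys≤b) = foldr-preservesᵇ ℤ.⊔-lub y≤b ys≤b

  minList-≤ : ∀ {x xs} → x ∈ₗ xs → minList G xs ≤ x
  minList-≤ {x} {y ∷ ys} x∈ = foldr-preservesᵒ pres y ys (start x∈)
    where
    pres : ∀ a b → a ≤ x ⊎ b ≤ x → a ⊓ b ≤ x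
    pres a b = [ ℤ.i≤j⇒i⊓k≤j b , ℤ.i≤j⇒k⊓i≤j a ]
    start : x ∈ₗ y ∷ ys → y ≤ x ⊎ Any (_≤ x) ys
    start (Any.here refl)  = inj₁ ℤ.≤-refl
    start (Any.there x∈ys) = inj₂ (lose x∈ys ℤ.≤-refl)

  ≤-minList : ∀ {x xs b} → x ∈ₗ xs → All (b ≤_) xs → b ≤ minList G xs
  ≤-minList {xs = y ∷ ys} _ (b≤y ∷ b≤ys) = foldr-preservesᵇ ℤ.⊓-glb b≤y b≤ys

  maxList-neg : ∀ xs → maxList G (map -_ xs) ≡ - minList G xs
  maxList-neg []       = refl
  maxList-neg (y ∷ ys) = trans (foldr-map _⊔_ -_ (- y) ys) (sym (foldr-fusion -_ y ℤ.neg-distrib-⊓-⊔ ys))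

  minList-neg : ∀ xs → minList G (map -_ xs) ≡ - maxList G xs
  minList-neg []       = refl
  minList-neg (y ∷ ys) = trans (foldr-map _⊓_ -_ (- y) ys) (sym (foldr-fusion -_ y ℤ.neg-distrib-⊔-⊓ ys))

module _ {n : ℕ} (G : BipGraph n) where

  Adj : Fin n → Fin n → Set
  Adj u v = T (adj G u v)

  Adj-sym : ∀ {u v} → Adj u v → Adj v u
  Adj-sym {u} {v} = subst T (adj-sym G u v)

  colour-opposite : ∀ {u v} → Adj u v → colour G v ≡ not (colour G u)
  colour-opposite {u} {v} a = adj-bip G v u (to T-≡ (Adj-sym a))

  Adj-black⇒white : ∀ {u v} → Adj u v → colour G u ≡ true → colour G v ≡ false
  Adj-black⇒white a black = trans (colour-opposite a) (cong not black)

  Adj-white⇒black : ∀ {u v} → Adj u v → colour G u ≡ false → colour G v ≡ true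
  Adj-white⇒black a white = trans (colour-opposite a) (cong not white)

  monochromatic-edge : ∀ {u v} → Adj u v → colour G u ≡ colour G v → ⊥
  monochromatic-edge a same = not-¬ (sym same) (colour-opposite a)

  black⇒¬white : ∀ {v} → colour G v ≡ true → colour G v ≢ false
  black⇒¬white black white = contradiction (trans (sym black) white) λ ()

  NbrIn : Subset n → Fin n → Set
  NbrIn S u = ∃ λ w → w ∈ S × Adj u w

  NbrIn-mono : ∀ {S S' u} → S ⊆ S' → NbrIn S u → NbrIn S' u
  NbrIn-mono S⊆S' (w , w∈S , a) = w , S⊆S' w∈S , a

  HasEdge : Subset n → Set
  HasEdge S = ∃ λ u → u ∈ S × NbrIn S u

  T-anyFin : ∀ {m} {p : Fin m → Bool} → T (anyFin G p) ⇔ ∃ λ i → T (p i)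
  T-anyFin {m} {p} = mk⇔ (satisfied ∘ any⁻ p (allFin m)) (λ (i , t) → any⁺ p (lose (∈-allFin i) t))

  T-mem∧ : ∀ {S w b} → T (mem G S w ∧ b) ⇔ (w ∈ S × T b)
  T-mem∧ = ⇔.trans T-∧ (⇔.sym ∈⇔T-lookup ×-⇔ ⇔.refl)

  T-hasNbr : ∀ {S u} → T (hasNbr G S u) ⇔ NbrIn S u
  T-hasNbr = ⇔.trans T-anyFin (∃-⇔ T-mem∧)

  T-hasEdge : ∀ {S} → T (hasEdge G S) ⇔ HasEdge S
  T-hasEdge = ⇔.trans T-anyFin (∃-⇔ (⇔.trans T-mem∧ (⇔.refl ×-⇔ T-hasNbr)))

  NbrIn? : ∀ S u → Dec (NbrIn S u)
  NbrIn? S u = Dec.map T-hasNbr (T? _)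

  HasEdge? : ∀ S → Dec (HasEdge S)
  HasEdge? S = Dec.map T-hasEdge (T? _)

  hasEdge≡true : ∀ {S} → HasEdge S → hasEdge G S ≡ true
  hasEdge≡true = to T-≡ ∘ from T-hasEdge

  hasEdge≡false : ∀ {S} → ¬ HasEdge S → hasEdge G S ≡ false
  hasEdge≡false {S} ¬e with hasEdge G S in e
  ... | true  = contradiction (to T-hasEdge (from T-≡ e)) ¬e
  ... | false = refl

  ∣S∣≤0⇒¬HasEdge : ∀ {S} → ∣ S ∣ ℕ.≤ 0 → ¬ HasEdge S
  ∣S∣≤0⇒¬HasEdge |S|≤0 (u , u∈S , _) = ℕ.n≮0 (ℕ.<-≤-trans (x∈p⇒∣p-x∣<∣p∣ u∈S) |S|≤0)

  HasEdge⇒black : ∀ {S} → HasEdge S → ∃ λ x → x ∈ S × colour G x ≡ true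
  HasEdge⇒black (u , u∈S , w , w∈S , a) with colour G u in cu
  ... | true  = u , u∈S , cu
  ... | false = w , w∈S , Adj-white⇒black a cu

  HasEdge⇒white : ∀ {S} → HasEdge S → ∃ λ y → y ∈ S × colour G y ≡ false × NbrIn S y
  HasEdge⇒white (u , u∈S , w , w∈S , a) with colour G u in cu
  ... | true  = w , w∈S , Adj-black⇒white a cu , u , u∈S , Adj-sym a
  ... | false = u , u∈S , cu , w , w∈S , a

  ClosedNbr : Fin n → Fin n → Set
  ClosedNbr x u = u ≡ x ⊎ Adj x u

  StrandedBy : Subset n → Fin n → Fin n → Set
  StrandedBy S x u = NbrIn S u × (∀ {w} → w ∈ S → Adj u w → ClosedNbr x w)

  ∈closedNbh⇔ : ∀ {S x u} → u ∈ closedNbh G S x ⇔ (u ∈ S × ClosedNbr x u)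
  ∈closedNbh⇔ {x = x} {u} =
    ⇔.trans ∈-tabulate⇔ (⇔.trans T-mem∧ (⇔.refl ×-⇔ ⇔.trans T-∨ (True⇔ (u Data.Fin.≟ x) ⊎-⇔ ⇔.refl)))

  ∈Rmv⇔ : ∀ {S x u} → u ∈ Rmv G S x ⇔
          (u ∈ closedNbh G S x ⊎ (u ∈ S ─ closedNbh G S x × NbrIn S u × ¬ NbrIn (S ─ closedNbh G S x) u))
  ∈Rmv⇔ {S} {x} = ⇔.trans (mk⇔ (x∈p∪q⁻ (closedNbh G S x) _) x∈p∪q⁺)
    (⇔.refl ⊎-⇔ ⇔.trans ∈-tabulate⇔
                  (⇔.trans T-mem∧ (⇔.refl ×-⇔ ⇔.trans T-∧ (T-hasNbr ×-⇔ ⇔.trans T-not⇔¬T (¬-⇔ T-hasNbr)))))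

  ∈Rmv⁻ : ∀ {S x u} → u ∈ Rmv G S x → u ∈ S × (ClosedNbr x u ⊎ StrandedBy S x u)
  ∈Rmv⁻ {S} {x} u∈R with to (∈Rmv⇔ {S} {x}) u∈R
  ... | inj₁ u∈N = Product.map₂ inj₁ (to (∈closedNbh⇔ {S} {x}) u∈N)
  ... | inj₂ (u∈S─N , nb , ¬nb) = proj₁ (x∈p─q⁻ u∈S─N) , inj₂ (nb , closed)
    where
    closed : ∀ {w} → w ∈ S → Adj _ w → ClosedNbr x w
    closed {w} w∈S a with w ∈? closedNbh G S x
    ... | yes w∈N = proj₂ (to (∈closedNbh⇔ {S} {x}) w∈N)
    ... | no  w∉N = contradiction (w , x∈p∧x∉q⇒x∈p─q w∈S w∉N , a) ¬nb

  ∈Rmv⁺ : ∀ {S x u} → u ∈ S → ClosedNbr x u ⊎ StrandedBy S x u → u ∈ Rmv G S x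
  ∈Rmv⁺ {S} {x} u∈S (inj₁ c) = from (∈Rmv⇔ {S} {x}) (inj₁ (from (∈closedNbh⇔ {S} {x}) (u∈S , c)))
  ∈Rmv⁺ {S} {x} {u} u∈S (inj₂ (nb , closed)) with u ∈? closedNbh G S x
  ... | yes u∈N = from (∈Rmv⇔ {S} {x}) (inj₁ u∈N)
  ... | no  u∉N = from (∈Rmv⇔ {S} {x}) (inj₂ (x∈p∧x∉q⇒x∈p─q u∈S u∉N , nb , isolated))
    where
    isolated : ¬ NbrIn (S ─ closedNbh G S x) u
    isolated (w , w∈S─N , a) =
      let w∈S , w∉N = x∈p─q⁻ w∈S─N in w∉N (from (∈closedNbh⇔ {S} {x}) (w∈S , closed w∈S a))

  ∉Rmv⁻ : ∀ {S x u} → u ∈ S → u ∉ Rmv G S x →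
          ¬ ClosedNbr x u × (NbrIn S u → ∃ λ w → w ∈ S × Adj u w × ¬ ClosedNbr x w)
  ∉Rmv⁻ {S} {x} {u} u∈S u∉R = u∉R ∘ ∈Rmv⁺ {S} {x} u∈S ∘ inj₁ , escape
    where
    escape : NbrIn S u → ∃ λ w → w ∈ S × Adj u w × ¬ ClosedNbr x w
    escape nb with NbrIn? (S ─ closedNbh G S x) u
    ... | yes (w , w∈S─N , a) =
      let w∈S , w∉N = x∈p─q⁻ w∈S─N in w , w∈S , a , λ c → w∉N (from (∈closedNbh⇔ {S} {x}) (w∈S , c))
    ... | no ¬nb = contradiction (from (∈Rmv⇔ {S} {x}) (inj₂ (u∈S─N , nb , ¬nb))) u∉R
      where u∈S─N = x∈p∧x∉q⇒x∈p─q u∈S (u∉R ∘ from (∈Rmv⇔ {S} {x}) ∘ inj₁)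

  Rmv⊆ : ∀ {S x} → Rmv G S x ⊆ S
  Rmv⊆ {S} {x} = proj₁ ∘ ∈Rmv⁻ {S} {x}

  x∈Rmv : ∀ {S x} → x ∈ S → x ∈ Rmv G S x
  x∈Rmv {S} {x} x∈S = ∈Rmv⁺ {S} {x} x∈S (inj₁ (inj₁ refl))

  ∣S─Rmv∣≤ : ∀ {S x k} → x ∈ S → ∣ S ∣ ℕ.≤ suc k → ∣ S ─ Rmv G S x ∣ ℕ.≤ k
  ∣S─Rmv∣≤ {S} {x} x∈S |S|≤1+k = ℕ.≤-pred (ℕ.<-≤-trans ∣S─Rmv∣<∣S∣ |S|≤1+k)
    where ∣S─Rmv∣<∣S∣ = p∩q≢∅⇒∣p─q∣<∣p∣ S (Rmv G S x) (x , x∈p∩q⁺ (x∈S , x∈Rmv x∈S))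

  ∣Rmv∣+∣S─Rmv∣≡∣S∣ : ∀ S x → ∣ Rmv G S x ∣ℤ + ∣ S ─ Rmv G S x ∣ℤ ≡ ∣ S ∣ℤ
  ∣Rmv∣+∣S─Rmv∣≡∣S∣ S x =
    trans (sym (ℤ.pos-+ ∣ Rmv G S x ∣ ∣ S ─ Rmv G S x ∣)) (cong +_ (∣q∣+∣p─q∣≡∣p∣ (Rmv⊆ {S} {x})))

  ∈-moves⇔ : ∀ {c S x} → x ∈ₗ moves G c S ⇔ (x ∈ S × colour G x ≡ c)
  ∈-moves⇔ {c} {S} {x} = mk⇔
    (Product.map₂ toWitness ∘ to T-mem∧ ∘ proj₂ ∘ ∈-filter⁻ (T? ∘ legal) {xs = allFin n})
    (∈-filter⁺ (T? ∘ legal) (∈-allFin x) ∘ from T-mem∧ ∘ Product.map₂ fromWitness)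
    where
    legal : Fin n → Bool
    legal v = mem G S v ∧ ⌊ colour G v Bool.≟ c ⌋

  map-cong-moves : ∀ {c S} {f g : Fin n → ℤ} → (∀ {x} → x ∈ S → f x ≡ g x) →
                   map f (moves G c S) ≡ map g (moves G c S)
  map-cong-moves f≗g = map-cong-local (All.tabulate (f≗g ∘ proj₁ ∘ to ∈-moves⇔))

  scores-edgeless : ∀ k {S} → ¬ HasEdge S → Ls′ G k S ≡ base G S × Rs′ G k S ≡ base G S
  scores-edgeless zero    ¬e = refl , refl
  scores-edgeless (suc k) ¬e rewrite hasEdge≡false ¬e = refl , refl

  Ls≡Rs-edgeless : ∀ {S} → ¬ HasEdge S → Ls G S ≡ Rs G S
  Ls≡Rs-edgeless ¬e = trans (proj₁ (scores-edgeless n ¬e)) (sym (proj₂ (scores-edgeless n ¬e)))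

  leftValue′ rightValue′ : ℕ → Subset n → Fin n → ℤ
  leftValue′  k S x = ∣ Rmv G S x ∣ℤ + Rs′ G k (S ─ Rmv G S x)
  rightValue′ k S y = - ∣ Rmv G S y ∣ℤ + Ls′ G k (S ─ Rmv G S y)

  Ls′-step : ∀ k {S} → HasEdge S → Ls′ G (suc k) S ≡ maxList G (map (leftValue′ k S) (moves G true S))
  Ls′-step k e rewrite hasEdge≡true e = refl

  Rs′-step : ∀ k {S} → HasEdge S → Rs′ G (suc k) S ≡ minList G (map (rightValue′ k S) (moves G false S))
  Rs′-step k e rewrite hasEdge≡true e = refl

  fuel-irrelevant : ∀ {k k'} S → ∣ S ∣ ℕ.≤ k → k ℕ.≤ k' →
                    Ls′ G k S ≡ Ls′ G k' S × Rs′ G k S ≡ Rs′ G k' S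
  fuel-irrelevant S _ _ with HasEdge? S
  fuel-irrelevant {k} {k'} S _ _ | no ¬e =
    trans (proj₁ (scores-edgeless k ¬e)) (sym (proj₁ (scores-edgeless k' ¬e))) ,
    trans (proj₂ (scores-edgeless k ¬e)) (sym (proj₂ (scores-edgeless k' ¬e)))
  fuel-irrelevant {zero} S |S|≤0 _ | yes e = contradiction e (∣S∣≤0⇒¬HasEdge |S|≤0)
  fuel-irrelevant {suc k} {suc k'} S |S|≤1+k (ℕ.s≤s k≤k') | yes e =
    trans (Ls′-step k e) (trans (cong (maxList G) (map-cong-moves left)) (sym (Ls′-step k' e))) ,
    trans (Rs′-step k e) (trans (cong (minList G) (map-cong-moves right)) (sym (Rs′-step k' e)))
    where
    after : ∀ {x} → x ∈ S → Ls′ G k (S ─ Rmv G S x) ≡ Ls′ G k' (S ─ Rmv G S x) ×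
                              Rs′ G k (S ─ Rmv G S x) ≡ Rs′ G k' (S ─ Rmv G S x)
    after x∈S = fuel-irrelevant _ (∣S─Rmv∣≤ x∈S |S|≤1+k) k≤k'
    left : ∀ {x} → x ∈ S → leftValue′ k S x ≡ leftValue′ k' S x
    left {x} x∈S = cong (_+_ ∣ Rmv G S x ∣ℤ) (proj₂ (after x∈S))
    right : ∀ {y} → y ∈ S → rightValue′ k S y ≡ rightValue′ k' S y
    right {y} y∈S = cong (_+_ (- ∣ Rmv G S y ∣ℤ)) (proj₁ (after y∈S))

  leftValue rightValue : Subset n → Fin n → ℤ
  leftValue  = leftValue′ n
  rightValue = rightValue′ n

  scores-unfold : ∀ {S} → HasEdge S →
                  Ls G S ≡ maxList G (map (leftValue S) (moves G true S)) ×
                  Rs G S ≡ minList G (map (rightValue S) (moves G false S))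
  scores-unfold {S} e = unfold n (∣p∣≤n S) ℕ.≤-refl
    where
    unfold : ∀ k → ∣ S ∣ ℕ.≤ k → k ℕ.≤ n →
             Ls′ G k S ≡ maxList G (map (leftValue S) (moves G true S)) ×
             Rs′ G k S ≡ minList G (map (rightValue S) (moves G false S))
    unfold zero    |S|≤0   _   = contradiction e (∣S∣≤0⇒¬HasEdge |S|≤0)
    unfold (suc k) |S|≤1+k k<n =
      trans (Ls′-step k e) (cong (maxList G) (map-cong-moves left)) ,
      trans (Rs′-step k e) (cong (minList G) (map-cong-moves right))
      where
      after : ∀ {x} → x ∈ S → Ls′ G k (S ─ Rmv G S x) ≡ Ls G (S ─ Rmv G S x) ×
                                Rs′ G k (S ─ Rmv G S x) ≡ Rs G (S ─ Rmv G S x)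
      after x∈S = fuel-irrelevant _ (∣S─Rmv∣≤ x∈S |S|≤1+k) (ℕ.<⇒≤ k<n)
      left : ∀ {x} → x ∈ S → leftValue′ k S x ≡ leftValue S x
      left {x} x∈S = cong (_+_ ∣ Rmv G S x ∣ℤ) (proj₂ (after x∈S))
      right : ∀ {y} → y ∈ S → rightValue′ k S y ≡ rightValue S y
      right {y} y∈S = cong (_+_ (- ∣ Rmv G S y ∣ℤ)) (proj₁ (after y∈S))

  leftValue≤Ls : ∀ {S x} → HasEdge S → x ∈ S → colour G x ≡ true → leftValue S x ≤ Ls G S
  leftValue≤Ls {S} e x∈S black = ℤ.≤-trans
    (≤-maxList G (∈-map⁺ (leftValue S) (from ∈-moves⇔ (x∈S , black))))
    (ℤ.≤-reflexive (sym (proj₁ (scores-unfold e))))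

  Ls≤ : ∀ {S b} → HasEdge S → (∀ {x} → x ∈ S → colour G x ≡ true → leftValue S x ≤ b) → Ls G S ≤ b
  Ls≤ {S} e bound with HasEdge⇒black e
  ... | x , x∈S , black = ℤ.≤-trans (ℤ.≤-reflexive (proj₁ (scores-unfold e)))
    (maxList-≤ G (∈-map⁺ (leftValue S) (from ∈-moves⇔ (x∈S , black)))
                 (All.map⁺ (All.tabulate (λ m → let x∈S , black = to ∈-moves⇔ m in bound x∈S black))))

  Rs≤rightValue : ∀ {S y} → HasEdge S → y ∈ S → colour G y ≡ false → Rs G S ≤ rightValue S y
  Rs≤rightValue {S} e y∈S white = ℤ.≤-trans
    (ℤ.≤-reflexive (proj₂ (scores-unfold e)))
    (minList-≤ G (∈-map⁺ (rightValue S) (from ∈-moves⇔ (y∈S , white))))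

  ≤Rs : ∀ {S b} → HasEdge S → (∀ {y} → y ∈ S → colour G y ≡ false → b ≤ rightValue S y) → b ≤ Rs G S
  ≤Rs {S} e bound with HasEdge⇒white e
  ... | y , y∈S , white , _ = ℤ.≤-trans
    (≤-minList G (∈-map⁺ (rightValue S) (from ∈-moves⇔ (y∈S , white)))
                 (All.map⁺ (All.tabulate (λ m → let y∈S , white = to ∈-moves⇔ m in bound y∈S white))))
    (ℤ.≤-reflexive (sym (proj₂ (scores-unfold e))))

  -- P is a position of the game on G and K one of the game on G ∖ W, played side by side.
  record Coupled (P K : Subset n) : Set where
    field
      P∖K-white         : ∀ {u v} → u ∈ P → u ∉ K → v ∈ K → Adj u v → colour G u ≡ false
      K∖P-isolatedBlack : ∀ {v} → v ∈ K → v ∉ P → colour G v ≡ true × ¬ NbrIn K v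

  module _ {P K : Subset n} (c : Coupled P K) where
    open Coupled c

    nbr∈P : ∀ {v w} → v ∈ K → w ∈ K → Adj v w → w ∈ P
    nbr∈P {v} {w} v∈K w∈K a with w ∈? P
    ... | yes w∈P = w∈P
    ... | no  w∉P = contradiction (v , v∈K , Adj-sym a) (proj₂ (K∖P-isolatedBlack w∈K w∉P))

    white∈P : ∀ {v} → v ∈ K → colour G v ≡ false → v ∈ P
    white∈P {v} v∈K white with v ∈? P
    ... | yes v∈P = v∈P
    ... | no  v∉P = contradiction white (black⇒¬white (proj₁ (K∖P-isolatedBlack v∈K v∉P)))

    black∉K⇒¬NbrIn : ∀ {x} → x ∈ P → x ∉ K → colour G x ≡ true → ¬ NbrIn K x
    black∉K⇒¬NbrIn x∈P x∉K black (v , v∈K , a) = black⇒¬white black (P∖K-white x∈P x∉K v∈K a)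

    white∈K⇒¬NbrIn : ¬ HasEdge K → ∀ {v} → v ∈ K → colour G v ≡ false → ¬ NbrIn P v
    white∈K⇒¬NbrIn ¬eK {v} v∈K white (u , u∈P , a) with u ∈? K
    ... | yes u∈K = ¬eK (v , v∈K , u , u∈K , a)
    ... | no  u∉K = monochromatic-edge a (trans white (sym (P∖K-white u∈P u∉K v∈K (Adj-sym a))))

    ¬HasEdge-coupled : ¬ HasEdge P → ¬ HasEdge K
    ¬HasEdge-coupled ¬eP (u , u∈K , w , w∈K , a) with u ∈? P
    ... | yes u∈P = ¬eP (u , u∈P , w , nbr∈P u∈K w∈K a , a)
    ... | no  u∉P = proj₂ (K∖P-isolatedBlack u∈K u∉P) (w , w∈K , a)

    coupled-same-move : ∀ {x} → x ∈ P → x ∈ K → Coupled (P ─ Rmv G P x) (K ─ Rmv G K x)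
    coupled-same-move {x} x∈P x∈K = record { P∖K-white = white ; K∖P-isolatedBlack = isolatedBlack }
      where
      white : ∀ {u v} → u ∈ P ─ Rmv G P x → u ∉ K ─ Rmv G K x → v ∈ K ─ Rmv G K x → Adj u v →
              colour G u ≡ false
      white {u} u∈P' u∉K' v∈K' a with x∈p─q⁻ u∈P' | x∈p─q⁻ v∈K' | u ∈? K
      ... | u∈P , _    | v∈K , _    | no  u∉K = P∖K-white u∈P u∉K v∈K a
      ... | u∈P , u∉RP | v∈K , v∉RK | yes u∈K with ∈Rmv⁻ {K} {x} (x∈p∧x∉p─q⇒x∈q u∈K u∉K')
      ...   | _ , inj₁ closed       = contradiction (∈Rmv⁺ {P} {x} u∈P (inj₁ closed)) u∉RP
      ...   | _ , inj₂ (_ , closed) = contradiction (∈Rmv⁺ {K} {x} v∈K (inj₁ (closed v∈K a))) v∉RK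

      isolatedBlack : ∀ {v} → v ∈ K ─ Rmv G K x → v ∉ P ─ Rmv G P x →
                      colour G v ≡ true × ¬ NbrIn (K ─ Rmv G K x) v
      isolatedBlack {v} v∈K' v∉P' with x∈p─q⁻ v∈K' | v ∈? P
      ... | v∈K , _ | no v∉P =
        Product.map₂ (λ ¬nb → ¬nb ∘ NbrIn-mono (p─q⊆p K _)) (K∖P-isolatedBlack v∈K v∉P)
      ... | v∈K , v∉RK | yes v∈P with ∈Rmv⁻ {P} {x} (x∈p∧x∉p─q⇒x∈q v∈P v∉P')
      ...   | _ , inj₁ closed = contradiction closed (proj₁ (∉Rmv⁻ {K} {x} v∈K v∉RK))
      ...   | _ , inj₂ ((u , u∈P , a) , closed) = black , isolated
        where
        black : colour G v ≡ true
        black with u ∈? K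
        ... | no  u∉K = Adj-white⇒black (Adj-sym a) (P∖K-white u∈P u∉K v∈K (Adj-sym a))
        ... | yes u∈K = let w , w∈K , aw , ¬closed = proj₂ (∉Rmv⁻ {K} {x} v∈K v∉RK) (u , u∈K , a)
                        in contradiction (closed (nbr∈P v∈K w∈K aw) aw) ¬closed
        isolated : ¬ NbrIn (K ─ Rmv G K x) v
        isolated (w , w∈K' , aw) = let w∈K , w∉RK = x∈p─q⁻ w∈K'
                                   in w∉RK (∈Rmv⁺ {K} {x} w∈K (inj₁ (closed (nbr∈P v∈K w∈K aw) aw)))

    coupled-black-moves : ∀ {x x'} → x ∈ P → x ∉ K → colour G x ≡ true → x' ∈ K → colour G x' ≡ true →
                          Coupled (P ─ Rmv G P x) (K ─ Rmv G K x')
    coupled-black-moves {x} {x'} x∈P x∉K black x'∈K black' =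
      record { P∖K-white = white ; K∖P-isolatedBlack = isolatedBlack }
      where
      ¬NbrIn-x = black∉K⇒¬NbrIn x∈P x∉K black

      white : ∀ {u v} → u ∈ P ─ Rmv G P x → u ∉ K ─ Rmv G K x' → v ∈ K ─ Rmv G K x' → Adj u v →
              colour G u ≡ false
      white {u} u∈P' u∉K' v∈K' a with x∈p─q⁻ u∈P' | x∈p─q⁻ v∈K' | u ∈? K
      ... | u∈P , _ | v∈K , _    | no  u∉K = P∖K-white u∈P u∉K v∈K a
      ... | _       | v∈K , v∉RK | yes u∈K with ∈Rmv⁻ {K} {x'} (x∈p∧x∉p─q⇒x∈q u∈K u∉K')
      ...   | _ , inj₁ (inj₁ refl)  = contradiction (∈Rmv⁺ {K} {x'} v∈K (inj₁ (inj₂ a))) v∉RK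
      ...   | _ , inj₁ (inj₂ a')    = Adj-black⇒white a' black'
      ...   | _ , inj₂ (_ , closed) = contradiction (∈Rmv⁺ {K} {x'} v∈K (inj₁ (closed v∈K a))) v∉RK

      isolatedBlack-K : ∀ {v} → v ∈ K → v ∉ P ─ Rmv G P x → colour G v ≡ true × ¬ NbrIn K v
      isolatedBlack-K {v} v∈K v∉P' with v ∈? P
      ... | no  v∉P = K∖P-isolatedBlack v∈K v∉P
      ... | yes v∈P with ∈Rmv⁻ {P} {x} (x∈p∧x∉p─q⇒x∈q v∈P v∉P')
      ...   | _ , inj₁ (inj₁ refl) = contradiction v∈K x∉K
      ...   | _ , inj₁ (inj₂ a)    = contradiction (v , v∈K , a) ¬NbrIn-x
      ...   | _ , inj₂ ((u , u∈P , a) , closed) = black-v , isolated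
        where
        black-v : colour G v ≡ true
        black-v with closed u∈P a
        ... | inj₁ refl = contradiction (v , v∈K , Adj-sym a) ¬NbrIn-x
        ... | inj₂ a'   = Adj-white⇒black (Adj-sym a) (Adj-black⇒white a' black)
        isolated : ¬ NbrIn K v
        isolated (w , w∈K , aw) with closed (nbr∈P v∈K w∈K aw) aw
        ... | inj₁ refl = contradiction w∈K x∉K
        ... | inj₂ a'   = contradiction (w , w∈K , a') ¬NbrIn-x

      isolatedBlack : ∀ {v} → v ∈ K ─ Rmv G K x' → v ∉ P ─ Rmv G P x →
                      colour G v ≡ true × ¬ NbrIn (K ─ Rmv G K x') v
      isolatedBlack v∈K' v∉P' =
        Product.map₂ (λ ¬nb → ¬nb ∘ NbrIn-mono (p─q⊆p K _)) (isolatedBlack-K (proj₁ (x∈p─q⁻ v∈K')) v∉P')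

    coupled-move-in-P : ¬ HasEdge K → ∀ {x} → x ∈ P → colour G x ≡ true ⊎ NbrIn P x →
                        Coupled (P ─ Rmv G P x) K
    coupled-move-in-P ¬eK {x} x∈P black⊎nb = record
      { P∖K-white         = P∖K-white ∘ proj₁ ∘ x∈p─q⁻
      ; K∖P-isolatedBlack = isolatedBlack
      }
      where
      isolatedBlack : ∀ {v} → v ∈ K → v ∉ P ─ Rmv G P x → colour G v ≡ true × ¬ NbrIn K v
      isolatedBlack {v} v∈K v∉P' with v ∈? P
      ... | no  v∉P = K∖P-isolatedBlack v∈K v∉P
      ... | yes v∈P = ¬-not ¬white , λ nb → ¬eK (v , v∈K , nb)
        where
        ¬white : colour G v ≢ false
        ¬white white with ∈Rmv⁻ {P} {x} (x∈p∧x∉p─q⇒x∈q v∈P v∉P')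
        ... | _ , inj₁ (inj₁ refl) = [ (λ bx → black⇒¬white bx white) , white∈K⇒¬NbrIn ¬eK v∈K white ] black⊎nb
        ... | _ , inj₁ (inj₂ a)   = white∈K⇒¬NbrIn ¬eK v∈K white (x , x∈P , Adj-sym a)
        ... | _ , inj₂ (nb , _)    = white∈K⇒¬NbrIn ¬eK v∈K white nb

    Rmv-white⊆ : ∀ {y} → y ∈ K → colour G y ≡ false → Rmv G K y ⊆ Rmv G P y
    Rmv-white⊆ {y} y∈K white {u} u∈RK with ∈Rmv⁻ {K} {y} u∈RK
    ... | u∈K , inj₁ (inj₁ refl) = x∈Rmv {P} (white∈P y∈K white)
    ... | u∈K , inj₁ (inj₂ a)    = ∈Rmv⁺ {P} {y} (nbr∈P y∈K u∈K a) (inj₁ (inj₂ a))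
    ... | u∈K , inj₂ ((w , w∈K , a) , closed) with colour G u in cu
    ...   | true with closed w∈K a
    ...     | inj₁ refl = ∈Rmv⁺ {P} {y} (nbr∈P w∈K u∈K (Adj-sym a)) (inj₁ (inj₂ (Adj-sym a)))
    ...     | inj₂ a'   = contradiction (trans cu (sym (Adj-white⇒black a' white))) (monochromatic-edge a)
    Rmv-white⊆ {y} y∈K white {u} u∈RK | u∈K , inj₂ ((w , w∈K , a) , closed) | false =
      ∈Rmv⁺ {P} {y} (nbr∈P w∈K u∈K (Adj-sym a)) (inj₂ ((w , nbr∈P u∈K w∈K a , a) , closedP))
      where
      closedP : ∀ {w'} → w' ∈ P → Adj u w' → ClosedNbr y w'
      closedP {w'} w'∈P a' with w' ∈? K
      ... | yes w'∈K = closed w'∈K a'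
      ... | no  w'∉K = contradiction (trans cu (sym (P∖K-white w'∈P w'∉K u∈K (Adj-sym a')))) (monochromatic-edge a')

  gap : Subset n → Subset n → ℤ
  gap P K = ∣ P ∣ℤ - ∣ K ∣ℤ

  ScoreGap : Subset n → Subset n → Set
  ScoreGap P K = Ls G P ≤ Ls G K + gap P K × Rs G P ≤ Rs G K + gap P K

  GapBelow : ℕ → Set
  GapBelow m = ∀ {P K} → ∣ P ∣ ℕ.≤ m → Coupled P K → ScoreGap P K

  ∣S∩blacks∣+∣S∩whites∣≡∣S∣ : ∀ S → ∣ S ∩ blacks G ∣ℤ + ∣ S ∩ whites G ∣ℤ ≡ ∣ S ∣ℤ
  ∣S∩blacks∣+∣S∩whites∣≡∣S∣ S = trans (sym (ℤ.pos-+ ∣ S ∩ blacks G ∣ _))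
    (cong +_ (subst (λ W → ∣ S ∩ blacks G ∣ ℕ.+ ∣ S ∩ W ∣ ≡ ∣ S ∣) (sym (tabulate-∘ not (colour G)))
                    (∣p∩q∣+∣p∩∁q∣≡∣p∣ S (blacks G))))

  -- base S - ∣ S ∣ℤ is minus twice the number of white vertices of S, and those of K all lie in P.
  base-gap : ∀ {P K} → Coupled P K → base G P ≤ base G K + gap P K
  base-gap {P} {K} c = begin
    bP - wP                                 ≤⟨ ℤ.i≤i+j (bP - wP) (d + d) {{nonNegative 0≤d+d}} ⟩
    (bP - wP) + (d + d)                     ≡⟨ rearrange bP wP bK wK ⟩
    (bK - wK) + ((bP + wP) - (bK + wK))     ≡⟨ cong (_+_ (bK - wK)) (cong₂ _-_ (∣S∩blacks∣+∣S∩whites∣≡∣S∣ P)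
                                                                            (∣S∩blacks∣+∣S∩whites∣≡∣S∣ K)) ⟩
    (bK - wK) + gap P K                     ∎
    where
    open ℤ.≤-Reasoning
    bP = ∣ P ∩ blacks G ∣ℤ ; wP = ∣ P ∩ whites G ∣ℤ ; bK = ∣ K ∩ blacks G ∣ℤ ; wK = ∣ K ∩ whites G ∣ℤ
    d = wP - wK
    whites⊆ : K ∩ whites G ⊆ P ∩ whites G
    whites⊆ x∈ = let x∈K , x∈W = x∈p∩q⁻ K (whites G) x∈
                 in x∈p∩q⁺ (white∈P c x∈K (to T-not-≡ (to ∈-tabulate⇔ x∈W)) , x∈W)
    0≤d+d : + 0 ≤ d + d
    0≤d+d = let 0≤d = ℤ.i≤j⇒0≤j-i (+≤+ (p⊆q⇒∣p∣≤∣q∣ whites⊆)) in ℤ.+-mono-≤ 0≤d 0≤d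
    rearrange : ∀ bP wP bK wK → (bP - wP) + ((wP - wK) + (wP - wK)) ≡ (bK - wK) + ((bP + wP) - (bK + wK))
    rearrange = solve-∀

  edgeless-gap : ∀ {P K} → Coupled P K → ¬ HasEdge P → ScoreGap P K
  edgeless-gap {P} {K} c ¬eP =
    subst₂ (λ a b → a ≤ b + gap P K) (sym (proj₁ scoresP)) (sym (proj₁ scoresK)) (base-gap c) ,
    subst₂ (λ a b → a ≤ b + gap P K) (sym (proj₂ scoresP)) (sym (proj₂ scoresK)) (base-gap c)
    where
    scoresP = scores-edgeless n ¬eP
    scoresK = scores-edgeless n (¬HasEdge-coupled c ¬eP)

  gap-split : ∀ P K x x' →
    (∣ Rmv G P x ∣ℤ + ∣ P ─ Rmv G P x ∣ℤ) - (∣ Rmv G K x' ∣ℤ + ∣ K ─ Rmv G K x' ∣ℤ) ≡ gap P K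
  gap-split P K x x' = cong₂ _-_ (∣Rmv∣+∣S─Rmv∣≡∣S∣ P x) (∣Rmv∣+∣S─Rmv∣≡∣S∣ K x')

  gap-removed : ∀ P K x {s t} → s ≤ t + gap (P ─ Rmv G P x) K → ∣ Rmv G P x ∣ℤ + s ≤ t + gap P K
  gap-removed P K x {s} {t} s≤ = begin
    rP + s                   ≤⟨ ℤ.+-monoʳ-≤ rP s≤ ⟩
    rP + (t + (p' - k))      ≡⟨ rearrange rP t p' k ⟩
    t + ((rP + p') - k)      ≡⟨ cong (λ g → t + (g - k)) (∣Rmv∣+∣S─Rmv∣≡∣S∣ P x) ⟩
    t + gap P K              ∎
    where
    open ℤ.≤-Reasoning
    rP = ∣ Rmv G P x ∣ℤ ; p' = ∣ P ─ Rmv G P x ∣ℤ ; k = ∣ K ∣ℤ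
    rearrange : ∀ r t p k → r + (t + (p - k)) ≡ t + ((r + p) - k)
    rearrange = solve-∀

  module _ {m : ℕ} (ih : GapBelow m) {P K : Subset n} (|P|≤1+m : ∣ P ∣ ℕ.≤ suc m) (c : Coupled P K) where
    open ℤ.≤-Reasoning

    leftValue-gap : ∀ {x x'} → x ∈ P → HasEdge K → x' ∈ K → colour G x' ≡ true →
                    Coupled (P ─ Rmv G P x) (K ─ Rmv G K x') → leftValue P x ≤ Ls G K + gap P K
    leftValue-gap {x} {x'} x∈P eK x'∈K black' c' = begin
      rP + Rs G P'                               ≤⟨ ℤ.+-monoʳ-≤ rP (proj₂ (ih (∣S─Rmv∣≤ x∈P |P|≤1+m) c')) ⟩
      rP + (Rs G K' + (p' - k'))                 ≡⟨ rearrange rP (Rs G K') p' k' rK ⟩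
      leftValue K x' + ((rP + p') - (rK + k'))   ≡⟨ cong (_+_ (leftValue K x')) (gap-split P K x x') ⟩
      leftValue K x' + gap P K                   ≤⟨ ℤ.+-monoˡ-≤ (gap P K) (leftValue≤Ls eK x'∈K black') ⟩
      Ls G K + gap P K                           ∎
      where
      P' = P ─ Rmv G P x ; K' = K ─ Rmv G K x'
      rP = ∣ Rmv G P x ∣ℤ ; rK = ∣ Rmv G K x' ∣ℤ ; p' = ∣ P' ∣ℤ ; k' = ∣ K' ∣ℤ
      rearrange : ∀ r s p k r' → r + (s + (p - k)) ≡ (r' + s) + ((r + p) - (r' + k))
      rearrange = solve-∀

    -- Left's move x in P is answered in K by x itself if possible, otherwise by any black vertex.
    Ls-gap : HasEdge P → Ls G P ≤ Ls G K + gap P K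
    Ls-gap eP = Ls≤ eP answer
      where
      answer : ∀ {x} → x ∈ P → colour G x ≡ true → leftValue P x ≤ Ls G K + gap P K
      answer {x} x∈P black with HasEdge? K | x ∈? K
      ... | no ¬eK | _ =
        subst (λ s → leftValue P x ≤ s + gap P K) (sym (Ls≡Rs-edgeless ¬eK))
              (gap-removed P K x {t = Rs G K}
                 (proj₂ (ih (∣S─Rmv∣≤ x∈P |P|≤1+m) (coupled-move-in-P c ¬eK x∈P (inj₁ black)))))
      ... | yes eK | yes x∈K = leftValue-gap x∈P eK x∈K black (coupled-same-move c x∈P x∈K)
      ... | yes eK | no  x∉K =
        let x' , x'∈K , black' = HasEdge⇒black eK
        in leftValue-gap x∈P eK x'∈K black' (coupled-black-moves c x∈P x∉K black x'∈K black')

    -- Right's move y in K is copied in P, where it removes at least as much.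
    rightValue-gap : HasEdge P → ∀ {y} → y ∈ K → colour G y ≡ false → Rs G P - gap P K ≤ rightValue K y
    rightValue-gap eP {y} y∈K white = begin
      Rs G P - g                                ≤⟨ ℤ.+-monoˡ-≤ (- g) (Rs≤rightValue eP y∈P white) ⟩
      (- rP + Ls G P') - g                      ≤⟨ ℤ.+-monoˡ-≤ (- g) (ℤ.+-monoʳ-≤ (- rP)
                                                     (proj₁ (ih (∣S─Rmv∣≤ y∈P |P|≤1+m) c'))) ⟩
      (- rP + (Ls G K' + (p' - k'))) - g        ≡⟨ cong (λ h → (- rP + (Ls G K' + (p' - k'))) - h)
                                                        (sym (gap-split P K y y)) ⟩
      (- rP + (Ls G K' + (p' - k'))) - ((rP + p') - (rK + k'))
                                                ≡⟨ rearrange rP (Ls G K') p' k' rK ⟩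
      rightValue K y - ((rP - rK) + (rP - rK))  ≤⟨ ℤ.i-j≤i (rightValue K y) _ {{nonNegative 0≤d+d}} ⟩
      rightValue K y                            ∎
      where
      y∈P = white∈P c y∈K white
      c' = coupled-same-move c y∈P y∈K
      P' = P ─ Rmv G P y ; K' = K ─ Rmv G K y
      rP = ∣ Rmv G P y ∣ℤ ; rK = ∣ Rmv G K y ∣ℤ ; p' = ∣ P' ∣ℤ ; k' = ∣ K' ∣ℤ ; g = gap P K
      0≤d+d : + 0 ≤ (rP - rK) + (rP - rK)
      0≤d+d = ℤ.+-mono-≤ 0≤d 0≤d
        where 0≤d = ℤ.i≤j⇒0≤j-i (+≤+ (p⊆q⇒∣p∣≤∣q∣ (Rmv-white⊆ c y∈K white)))
      rearrange : ∀ r l p k r' → (- r + (l + (p - k))) - ((r + p) - (r' + k)) ≡ (- r' + l) - ((r - r') + (r - r'))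
      rearrange = solve-∀

    Rs-gap : HasEdge P → Rs G P ≤ Rs G K + gap P K
    Rs-gap eP with HasEdge? K | HasEdge⇒white eP
    ... | yes eK | _ = i-k≤j⇒i≤j+k (≤Rs eK (rightValue-gap eP))
    ... | no ¬eK | y , y∈P , white , nb = begin
      Rs G P                          ≤⟨ Rs≤rightValue eP y∈P white ⟩
      - ∣ Rmv G P y ∣ℤ + Ls G P'      ≤⟨ ℤ.+-monoˡ-≤ (Ls G P') (ℤ.neg-≤-pos {∣ Rmv G P y ∣}) ⟩
      ∣ Rmv G P y ∣ℤ + Ls G P'        ≤⟨ gap-removed P K y {t = Ls G K} (proj₁ (ih |P'|≤m c')) ⟩
      Ls G K + gap P K                ≡⟨ cong (_+ gap P K) (Ls≡Rs-edgeless ¬eK) ⟩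
      Rs G K + gap P K                ∎
      where
      P' = P ─ Rmv G P y
      |P'|≤m = ∣S─Rmv∣≤ y∈P |P|≤1+m
      c' = coupled-move-in-P c ¬eK y∈P (inj₂ nb)

  coupled-gap : ∀ m → GapBelow m
  coupled-gap m {P} |P|≤m c with HasEdge? P
  ... | no ¬eP = edgeless-gap c ¬eP
  coupled-gap zero    |P|≤0   c | yes eP = contradiction eP (∣S∣≤0⇒¬HasEdge |P|≤0)
  coupled-gap (suc m) |P|≤1+m c | yes eP =
    Ls-gap (coupled-gap m) |P|≤1+m c eP , Rs-gap (coupled-gap m) |P|≤1+m c eP

  deleting-whites : ∀ W → (∀ v → v ∈ W → colour G v ≡ false) →
                    Ls G ⊤ ≤ Ls G (∁ W) + ∣ W ∣ℤ × Rs G ⊤ ≤ Rs G (∁ W) + ∣ W ∣ℤ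
  deleting-whites W white =
    subst (λ g → Ls G ⊤ ≤ Ls G (∁ W) + g × Rs G ⊤ ≤ Rs G (∁ W) + g) (∣⊤∣-∣∁p∣≡∣p∣ W)
          (coupled-gap n (∣p∣≤n ⊤) coupled)
    where
    coupled : Coupled ⊤ (∁ W)
    coupled = record
      { P∖K-white         = λ {u} _ u∉∁W _ _ → white u (x∉∁p⇒x∈p u∉∁W)
      ; K∖P-isolatedBlack = λ _ v∉⊤ → contradiction ∈⊤ v∉⊤
      }

swapColours : ∀ {n} → BipGraph n → BipGraph n
swapColours G = record
  { colour  = not ∘ colour G
  ; adj     = adj G
  ; adj-sym = adj-sym G
  ; adj-bip = λ u v h → cong not (adj-bip G u v h)
  }

module _ {n : ℕ} (G : BipGraph n) where

  base-swap : ∀ S → base (swapColours G) S ≡ - base G S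
  base-swap S = trans (cong (λ B → ∣ S ∩ whites G ∣ℤ - ∣ S ∩ B ∣ℤ) whites*≡blacks)
                      (flip ∣ S ∩ blacks G ∣ℤ ∣ S ∩ whites G ∣ℤ)
    where
    whites*≡blacks : whites (swapColours G) ≡ blacks G
    whites*≡blacks = tabulate-cong (not-involutive ∘ colour G)
    flip : ∀ b w → w - b ≡ - (b - w)
    flip = solve-∀

  moves-swap : ∀ c S → moves (swapColours G) c S ≡ moves G (not c) S
  moves-swap c S = filterᵇ-cong (λ v → cong (mem G S v ∧_) (flip (colour G v) c)) (allFin n)
    where
    flip : ∀ a c → ⌊ not a Bool.≟ c ⌋ ≡ ⌊ a Bool.≟ not c ⌋
    flip true  true  = refl
    flip true  false = refl
    flip false true  = refl
    flip false false = refl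

  scores-swap : ∀ k S → Ls′ (swapColours G) k S ≡ - Rs′ G k S × Rs′ (swapColours G) k S ≡ - Ls′ G k S
  scores-swap zero    S = base-swap S , base-swap S
  scores-swap (suc k) S with HasEdge? G S
  ... | no ¬e =
    let L* , R* = scores-edgeless (swapColours G) (suc k) ¬e
        L  , R  = scores-edgeless G (suc k) ¬e
    in trans L* (trans (base-swap S) (cong -_ (sym R))) , trans R* (trans (base-swap S) (cong -_ (sym L)))
  ... | yes e = Ls*≡ , Rs*≡
    where
    open ≡-Reasoning
    G* = swapColours G
    left*≡ : ∀ x → leftValue′ G* k S x ≡ - rightValue′ G k S x
    left*≡ x = trans (cong (_+_ ∣ Rmv G S x ∣ℤ) (proj₂ (scores-swap k (S ─ Rmv G S x)))) (eq ∣ Rmv G S x ∣ℤ _)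
      where eq : ∀ r l → r + - l ≡ - (- r + l)
            eq = solve-∀
    right*≡ : ∀ y → rightValue′ G* k S y ≡ - leftValue′ G k S y
    right*≡ y = trans (cong (_+_ (- ∣ Rmv G S y ∣ℤ)) (proj₁ (scores-swap k (S ─ Rmv G S y)))) (eq ∣ Rmv G S y ∣ℤ _)
      where eq : ∀ r s → - r + - s ≡ - (r + s)
            eq = solve-∀
    Ls*≡ : Ls′ G* (suc k) S ≡ - Rs′ G (suc k) S
    Ls*≡ = begin
      Ls′ G* (suc k) S                                 ≡⟨ Ls′-step G* k e ⟩
      maxList G* (map (leftValue′ G* k S) (moves G* true S))
                                                       ≡⟨ cong (maxList G* ∘ map _) (moves-swap true S) ⟩
      maxList G* (map (leftValue′ G* k S) ys)          ≡⟨ cong (maxList G*) (trans (map-cong left*≡ ys) (map-∘ ys)) ⟩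
      maxList G* (map -_ (map (rightValue′ G k S) ys)) ≡⟨ maxList-neg G* (map (rightValue′ G k S) ys) ⟩
      - minList G (map (rightValue′ G k S) ys)         ≡⟨ cong -_ (sym (Rs′-step G k e)) ⟩
      - Rs′ G (suc k) S                                ∎
      where ys = moves G false S
    Rs*≡ : Rs′ G* (suc k) S ≡ - Ls′ G (suc k) S
    Rs*≡ = begin
      Rs′ G* (suc k) S                                 ≡⟨ Rs′-step G* k e ⟩
      minList G* (map (rightValue′ G* k S) (moves G* false S))
                                                       ≡⟨ cong (minList G* ∘ map _) (moves-swap false S) ⟩
      minList G* (map (rightValue′ G* k S) xs)         ≡⟨ cong (minList G*) (trans (map-cong right*≡ xs) (map-∘ xs)) ⟩
      minList G* (map -_ (map (leftValue′ G k S) xs))  ≡⟨ minList-neg G* (map (leftValue′ G k S) xs) ⟩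
      - maxList G (map (leftValue′ G k S) xs)          ≡⟨ cong -_ (sym (Ls′-step G k e)) ⟩
      - Ls′ G (suc k) S                                ∎
      where xs = moves G true S

  deleting-blacks : ∀ B → (∀ v → v ∈ B → colour G v ≡ true) →
                    Rs G (∁ B) - ∣ B ∣ℤ ≤ Rs G ⊤ × Ls G (∁ B) - ∣ B ∣ℤ ≤ Ls G ⊤
  deleting-blacks B black = -i≤-j+k⇒j-k≤i (Rs G (∁ B)) -Rs≤ , -i≤-j+k⇒j-k≤i (Ls G (∁ B)) -Ls≤
    where
    bounds = deleting-whites (swapColours G) B (λ v v∈B → cong not (black v v∈B))
    -Rs≤ : - Rs G ⊤ ≤ - Rs G (∁ B) + ∣ B ∣ℤ
    -Rs≤ = subst₂ (λ a b → a ≤ b + ∣ B ∣ℤ) (proj₁ (scores-swap n ⊤)) (proj₁ (scores-swap n (∁ B))) (proj₁ bounds)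
    -Ls≤ : - Ls G ⊤ ≤ - Ls G (∁ B) + ∣ B ∣ℤ
    -Ls≤ = subst₂ (λ a b → a ≤ b + ∣ B ∣ℤ) (proj₂ (scores-swap n ⊤)) (proj₂ (scores-swap n (∁ B))) (proj₂ bounds)

theorem8 : {n : ℕ} (G : BipGraph n) (B₀ W₀ : Subset n) →
    (∀ v → v ∈ B₀ → colour G v ≡ true) →
    (∀ v → v ∈ W₀ → colour G v ≡ false) →
    (Ls G ⊤ ≤ Ls G (∁ W₀) + + ∣ W₀ ∣) ×
    (Rs G (∁ B₀) - + ∣ B₀ ∣ ≤ Rs G ⊤) ×
    (Ls G (∁ B₀) - + ∣ B₀ ∣ ≤ Ls G ⊤) ×
    (Rs G ⊤ ≤ Rs G (∁ W₀) + + ∣ W₀ ∣)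
theorem8 G B₀ W₀ black white =
  let Ls-W , Rs-W = deleting-whites G W₀ white
      Rs-B , Ls-B = deleting-blacks G B₀ black
  in Ls-W , Rs-B , Ls-B , Rs-W
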